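{- Let $a\in\mathbb{N}$, let $k \geq a+1$, and let $M$ be a strong $k$-chromatic-choosable graph with vertex set $\{v_1,\dots,v_n\}$. Let $H = M \square K_{a,1}$, where $K_{a,1}$ has partite sets $\{u_1,\dots,u_a\}$ and $\{w_1\}$. Suppose $L$ is a $(k+a-1)$-assignment for $H$ such that for each $i\in[n]$ the lists $L(v_i,u_1), L(v_i,u_2), \dots, L(v_i,u_a)$ are pairwise disjoint. Then there is at most one proper $L$-coloring of $H[\bigcup_{j=1}^a V_{u_j}]$ that is bad for the copy of $M$ corresponding to $w_1$.
   Context: All graphs are finite, simple and nonempty; $[k]=\{1,\dots,k\}$. A list assignment $L$ assigns to each vertex $v$ a set $L(v)$ of colors; a proper $L$-coloring is a proper coloring $c$ with $c(v)\in L(v)$ for all $v$; the graph is $L$-colorable if one exists. $L$ is a $k$-assignment if $|L(v)|=k$ for all $v$, and is constant if all lists are equal. A graph $G$ is strong $k$-chromatic-choosable if $\chi(G)=k$ and every $(k-1)$-assignment $L$ for which $G$ is not $L$-colorable is constant. The Cartesian product $M \square K$ has vertex set $V(M)\times V(K)$, with $(u,v)$ adjacent to $(u',v')$ iff either $u=u'$ and $vv'\in E(K)$, or $v=v'$ and $uu'\in E(M)$. For $u\in V(K_{a,1})$, $V_u$ is the set of vertices of $H$ with second coordinate $u$, and $H[V_u]$ is called the copy of $M$ corresponding to $u$. A proper $L$-coloring $f$ of $H[\bigcup_{j=1}^a V_{u_j}]$ is bad for the copy of $M$ corresponding to $w_1$ if there is no proper $L'$-coloring of $H[V_{w_1}]$,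 where $L'(v_i,w_1) = L(v_i,w_1)\setminus\{f(v_i,u_j): j\in[a]\}$ for each $i\in[n]$. -}

module Defs where

open import Level using (0ℓ)
open import Data.Nat using (ℕ; _<_; _∸_)
open import Data.Fin using (Fin)
open import Data.Product using (Σ; ∃; _×_; _,_; proj₁; proj₂)
open import Data.Sum using (_⊎_; inj₁; inj₂)
open import Data.Unit using (⊤; tt)
open import Data.Empty using (⊥)
open import Data.List using (List; length)
open import Data.List.Membership.Propositional using (_∈_)
open import Data.List.Relation.Unary.Unique.Propositional using (Unique)
open import Relation.Binary.PropositionalEquality using (_≡_; _≢_)
open import Relation.Nullary using (¬_)

record Graph (V : Set) : Set₁ where
  field
    Adj   : V → V → Set
    sym   : ∀ {x y} → Adj x y → Adj y x
    irrfl : ∀ {x} → ¬ Adj x x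
open Graph public

Proper : {V C : Set} → Graph V → (V → C) → Set
Proper G c = ∀ {x y} → Adj G x y → c x ≢ c y

Colorable : {V : Set} → Graph V → ℕ → Set
Colorable {V} G m = Σ (V → Fin m) (Proper G)

ChromaticNumber : {V : Set} → Graph V → ℕ → Set
ChromaticNumber G k = Colorable G k × (∀ m → m < k → ¬ Colorable G m)

-- A list assignment is given by its membership predicate "colour c is in L(v)".
-- Proper L-colouring (colours are natural numbers).
IsLColoring : {V : Set} → Graph V → (V → ℕ → Set) → (V → ℕ) → Set
IsLColoring G L c = Proper G c × (∀ v → L v (c v))

LColorable : {V : Set} → Graph V → (V → ℕ → Set) → Set
LColorable {V} G L = Σ (V → ℕ) (IsLColoring G L)

memL : {V : Set} → (V → List ℕ) → V → ℕ → Set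
memL L v c = c ∈ L v

KAssignment : {V : Set} → ℕ → (V → List ℕ) → Set
KAssignment k L = ∀ v → Unique (L v) × length (L v) ≡ k

Constant : {V : Set} → (V → List ℕ) → Set
Constant L = ∀ u v c → c ∈ L u → c ∈ L v

StrongChromaticChoosable : {V : Set} → Graph V → ℕ → Set
StrongChromaticChoosable {V} G k =
  ChromaticNumber G k ×
  (∀ (L : V → List ℕ) → KAssignment (k ∸ 1) L → ¬ LColorable G (memL L) → Constant L)

_□_ : {V W : Set} → Graph V → Graph W → Graph (V × W)
_□_ {V} {W} M K = record { Adj = A ; sym = s ; irrfl = i }
  where
  A : V × W → V × W → Set
  A (u , v) (u' , v') = (u ≡ u' × Adj K v v') ⊎ (v ≡ v' × Adj M u u')
  s : ∀ {x y} → A x y → A y x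
  s (inj₁ (_≡_.refl , e)) = inj₁ (_≡_.refl , sym K e)
  s (inj₂ (_≡_.refl , e)) = inj₂ (_≡_.refl , sym M e)
  i : ∀ {x} → ¬ A x x
  i (inj₁ (_ , e)) = irrfl K e
  i (inj₂ (_ , e)) = irrfl M e

-- K_{a,1}: vertices inj₁ j = u_(j+1) (j : Fin a), and inj₂ tt = w₁.
StarV : ℕ → Set
StarV a = Fin a ⊎ ⊤

u : {a : ℕ} → Fin a → StarV a
u j = inj₁ j

w₁ : {a : ℕ} → StarV a
w₁ = inj₂ tt

StarAdj : {a : ℕ} → StarV a → StarV a → Set
StarAdj (inj₁ _) (inj₂ _) = ⊤
StarAdj (inj₂ _) (inj₁ _) = ⊤
StarAdj _ _ = ⊥

K[_,1] : (a : ℕ) → Graph (StarV a)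
K[ a ,1] = record { Adj = StarAdj ; sym = s ; irrfl = i }
  where
  s : ∀ {x y : StarV a} → StarAdj x y → StarAdj y x
  s {inj₁ _} {inj₂ _} _ = tt
  s {inj₂ _} {inj₁ _} _ = tt
  i : ∀ {x : StarV a} → ¬ StarAdj x x
  i {inj₁ _} ()
  i {inj₂ _} ()

induced : {V : Set} → Graph V → (P : V → Set) → Graph (Σ V P)
induced G P = record { Adj = λ x y → Adj G (proj₁ x) (proj₁ y)
                     ; sym = sym G ; irrfl = irrfl G }

-- Membership of a vertex of M □ K_{a,1} in ⋃_j V_{u_j}, resp. in V_{w₁}.
InU : {n a : ℕ} → Fin n × StarV a → Set
InU (_ , inj₁ _) = ⊤
InU (_ , inj₂ _) = ⊥

InW : {n a : ℕ} → Fin n × StarV a → Set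
InW (_ , inj₁ _) = ⊥
InW (_ , inj₂ _) = ⊤

-- Bad colouring: f is a proper L-colouring of H[⋃_j V_{u_j}] (H = M □ K_{a,1})
-- such that H[V_{w₁}] has no proper L'-colouring, where
-- L'(v_i,w₁) = L(v_i,w₁) ∖ { f(v_i,u_j) : j ∈ [a] }.
IsBad : {n a : ℕ} → Graph (Fin n) → (Fin n × StarV a → List ℕ)
      → (Σ (Fin n × StarV a) InU → ℕ) → Set
IsBad {n} {a} M L f =
  IsLColoring (induced (M □ K[ a ,1]) InU) (λ x → memL L (proj₁ x)) f ×
  ¬ LColorable (induced (M □ K[ a ,1]) InW)
      (λ x c → c ∈ L (proj₁ x) × (∀ (j : Fin a) → f ((proj₁ (proj₁ x) , u j) , tt) ≢ c))

-- Write L'_f(v_i) = L(v_i,w₁) ∖ {f(v_i,u_j) : j ∈ [a]} for a bad colouring f.  These lists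
-- have at least k - 1 colours and admit no proper colouring of M, so strong choosability
-- (applied to (k-1)-sublists, and to one sublist shifted at a single vertex) forces them to be
-- one and the same list of exactly k - 1 colours; by counting, every f(v_i,u_j) then lies in
-- L(v_i,w₁).  Now let f, g be bad and c = f(v_i,u_j).  If c = g(v_i,u_j') then j' = j, since
-- the lists along the row are disjoint.  Otherwise c ∈ L'_g(v_i) = L'_g(v_{i'}) for every i',
-- while c ∉ L'_f(v_i) = L'_f(v_{i'}); so c occurs in every row of f, and the copy of M in
-- which it occurs is a proper a-colouring of M, contradicting χ(M) = k > a.
module Submission where

open import Defs hiding (sym)
open import Data.Nat using (ℕ; zero; suc; _+_; _∸_; _≤_; _<_; _≥_; z≤n; s≤s)
import Data.Nat as ℕ
open import Data.Nat.Properties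
  using (≤-trans; ≤-reflexive; ≤-antisym; ≮⇒≥; n≮n; +-suc; +-comm; +-monoʳ-≤; +-monoʳ-<; +-cancelʳ-≤;
         m≤n+m; m≤n⇒m⊓n≡m; ∸-monoˡ-≤; module ≤-Reasoning)
open import Data.Fin using (Fin; zero)
open import Data.Fin.Properties using () renaming (_≟_ to _≟ᶠ_)
open import Data.Product using (Σ; ∃; _×_; _,_; proj₁; proj₂)
open import Data.Sum using (inj₁; inj₂)
open import Data.Unit using (tt)
open import Data.Empty using (⊥; ⊥-elim)
open import Data.List using (List; []; _∷_; _++_; length; take; drop; filter; tabulate)
open import Data.List.Properties using (length-take; length-drop; length-tabulate; length-++-sucʳ; take-all)
open import Data.List.Membership.Propositional using (_∈_; _∉_)
open import Data.List.Membership.Propositional.Properties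
  using (∈-∃++; ∈-++⁻; ∈-++⁺ˡ; ∈-++⁺ʳ; ∈-filter⁺; ∈-filter⁻; ∈-tabulate⁺; ∈-tabulate⁻)
open import Data.List.Membership.DecPropositional ℕ._≟_ using (_∈?_; _∉?_)
open import Data.List.Relation.Binary.Subset.Propositional using (_⊆_)
open import Data.List.Relation.Binary.Subset.Propositional.Properties using (∈-∷⁺ʳ)
import Data.List.Relation.Binary.Sublist.Propositional as Sublist
open import Data.List.Relation.Binary.Sublist.Propositional.Properties using (take-⊆; drop-⊆)
open import Data.List.Relation.Unary.Any using (here; there)
import Data.List.Relation.Unary.All as All
open import Data.List.Relation.Unary.AllPairs using (_∷_)
open import Data.List.Relation.Unary.Unique.Propositional using (Unique)
import Data.List.Relation.Unary.Unique.Propositional.Properties as Unique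
open import Relation.Binary.Definitions using (DecidableEquality)
open import Relation.Binary.PropositionalEquality using (_≡_; _≢_; refl; sym; trans; subst; cong; cong₂)
open import Relation.Nullary using (¬_; yes; no; contradiction)
open import Relation.Nullary.Decidable using (decidable-stable)
open import Function using (_∘_)
open import Relation.Unary using (Pred; Decidable)
open import Relation.Unary.Properties using (∁?)

module _ {A : Set} where

  length-filter-partition : ∀ {ℓ} {P : Pred A ℓ} (P? : Decidable P) xs →
    length (filter (∁? P?) xs) + length (filter P? xs) ≡ length xs
  length-filter-partition P? [] = refl
  length-filter-partition P? (x ∷ xs) with P? x
  ... | yes _ = trans (+-suc _ _) (cong suc (length-filter-partition P? xs))
  ... | no _  = cong suc (length-filter-partition P? xs)

  Unique-⊆⇒length≤ : {xs ys : List A} → Unique xs → xs ⊆ ys → length xs ≤ length ys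
  Unique-⊆⇒length≤ {[]} _ _ = z≤n
  Unique-⊆⇒length≤ {x ∷ xs} (x≢xs ∷ xs!) x∷xs⊆ys
    with as , bs , refl ← ∈-∃++ (x∷xs⊆ys (here refl)) =
    ≤-trans (s≤s (Unique-⊆⇒length≤ xs! xs⊆as++bs)) (≤-reflexive (sym (length-++-sucʳ as x bs)))
    where
    xs⊆as++bs : xs ⊆ as ++ bs
    xs⊆as++bs c∈xs with ∈-++⁻ as (x∷xs⊆ys (there c∈xs))
    ... | inj₁ c∈as         = ∈-++⁺ˡ c∈as
    ... | inj₂ (here refl)  = contradiction refl (All.lookup x≢xs c∈xs)
    ... | inj₂ (there c∈bs) = ∈-++⁺ʳ as c∈bs

  take-tight : ∀ {k} {xs : List A} → Unique xs → k ≤ length xs → Unique (take k xs) × length (take k xs) ≡ k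
  take-tight {k} {xs} xs! k≤∣xs∣ = Unique.take⁺ k xs! , trans (length-take k xs) (m≤n⇒m⊓n≡m k≤∣xs∣)

  take-suc⊈drop-1 : ∀ k {xs : List A} → Unique xs → 0 < length xs → ¬ (take (suc k) xs ⊆ drop 1 xs)
  take-suc⊈drop-1 k {x ∷ _} (x≢xs ∷ _) _ ⊆tail = contradiction refl (All.lookup x≢xs (⊆tail (here refl)))

_∖_ : List ℕ → List ℕ → List ℕ
xs ∖ ys = filter (_∉? ys) xs

∈-∖⁻ : ∀ {c} xs ys → c ∈ xs ∖ ys → c ∈ xs × c ∉ ys
∈-∖⁻ xs ys = ∈-filter⁻ (_∉? ys) {xs = xs}

∈-∖⁺ : ∀ {c xs ys} → c ∈ xs → c ∉ ys → c ∈ xs ∖ ys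
∈-∖⁺ {ys = ys} = ∈-filter⁺ (_∉? ys)

module _ {xs : List ℕ} (ys : List ℕ) (xs! : Unique xs) where

  private
    common : List ℕ
    common = filter (_∈? ys) xs

    common! : Unique common
    common! = Unique.filter⁺ (_∈? ys) xs!

    common⊆ys : common ⊆ ys
    common⊆ys c∈common = proj₂ (∈-filter⁻ (_∈? ys) {xs = xs} c∈common)

    split : length (xs ∖ ys) + length common ≡ length xs
    split = length-filter-partition (_∈? ys) xs

  length≤length-∖+length : length xs ≤ length (xs ∖ ys) + length ys
  length≤length-∖+length = begin
    length xs                         ≡⟨ split ⟨
    length (xs ∖ ys) + length common  ≤⟨ +-monoʳ-≤ _ (Unique-⊆⇒length≤ common! common⊆ys) ⟩
    length (xs ∖ ys) + length ys      ∎
    where open ≤-Reasoning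

  length<length-∖+length : ∀ {y} → y ∈ ys → y ∉ xs → length xs < length (xs ∖ ys) + length ys
  length<length-∖+length {y} y∈ys y∉xs = begin-strict
    length xs                         ≡⟨ split ⟨
    length (xs ∖ ys) + length common  <⟨ +-monoʳ-< _ (Unique-⊆⇒length≤ y∷common! y∷common⊆ys) ⟩
    length (xs ∖ ys) + length ys      ∎
    where
    open ≤-Reasoning
    y∷common! : Unique (y ∷ common)
    y∷common! = All.tabulate (λ c∈common y≡c →
                  y∉xs (subst (_∈ xs) (sym y≡c) (proj₁ (∈-filter⁻ (_∈? ys) {xs = xs} c∈common))))
                ∷ common!
    y∷common⊆ys : y ∷ common ⊆ ys
    y∷common⊆ys = ∈-∷⁺ʳ y∈ys common⊆ys

χ≥2⇒¬¬∃≢ : ∀ {V : Set} (G : Graph V) {m} → ChromaticNumber G (suc (suc m)) → (v : V) → ¬ ¬ ∃ (v ≢_)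
χ≥2⇒¬¬∃≢ G (_ , fewer-colours-fail) v no-other =
  fewer-colours-fail 1 (s≤s (s≤s z≤n)) ((λ _ → zero) , monochromatic-proper)
  where
  monochromatic-proper : Proper G (λ _ → zero)
  monochromatic-proper {x} {y} x~y _ =
    no-other (x , λ v≡x → no-other (y , λ v≡y →
      irrfl G (subst (Adj G x) (trans (sym v≡y) v≡x) x~y)))

module _ {V : Set} (_≟_ : DecidableEquality V) (G : Graph V) {m : ℕ}
         (sc : StrongChromaticChoosable G (suc (suc m)))
         (P : V → List ℕ) (P-uncolorable : ¬ LColorable G (memL P)) where

  tight-sublists-constant : (Q : V → List ℕ) → KAssignment (suc m) Q → (∀ v → Q v ⊆ P v) → Constant Q
  tight-sublists-constant Q Q-tight Q⊆P = proj₂ sc Q Q-tight λ (c , c-proper , c∈Q) →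
    P-uncolorable (c , c-proper , λ v → Q⊆P v (c∈Q v))

  module _ (P-wide : ∀ v → Unique (P v) × suc m ≤ length (P v)) where

    private
      truncated : V → List ℕ
      truncated v = take (suc m) (P v)

      truncated-constant : Constant truncated
      truncated-constant = tight-sublists-constant truncated
        (λ v → take-tight (proj₁ (P-wide v)) (proj₂ (P-wide v)))
        (λ v → Sublist.lookup (take-⊆ (suc m) (P v)))

      module Shifted (v : V) (long : suc m < length (P v)) where

        shifted : V → List ℕ
        shifted w with v ≟ w
        ... | yes _ = take (suc m) (drop 1 (P v))
        ... | no  _ = truncated w

        shifted-tight : KAssignment (suc m) shifted
        shifted-tight w with v ≟ w
        ... | yes _ = take-tight (Unique.drop⁺ 1 (proj₁ (P-wide v)))
                        (subst (suc m ≤_) (sym (length-drop 1 (P v))) (∸-monoˡ-≤ 1 long))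
        ... | no  _ = take-tight (proj₁ (P-wide w)) (proj₂ (P-wide w))

        shifted⊆P : ∀ w → shifted w ⊆ P w
        shifted⊆P w with v ≟ w
        ... | yes refl = Sublist.lookup (drop-⊆ 1 (P v)) ∘ Sublist.lookup (take-⊆ (suc m) (drop 1 (P v)))
        ... | no  _    = Sublist.lookup (take-⊆ (suc m) (P w))

        shifted-elsewhere : ∀ w → v ≢ w → truncated w ⊆ shifted w
        shifted-elsewhere w v≢w with v ≟ w
        ... | yes v≡w = contradiction v≡w v≢w
        ... | no  _   = λ c∈ → c∈

        shifted-at : shifted v ⊆ drop 1 (P v)
        shifted-at with v ≟ v
        ... | yes _   = Sublist.lookup (take-⊆ (suc m) (drop 1 (P v)))
        ... | no  v≢v = contradiction refl v≢v

      -- Comparing the two constant assignments at a second vertex w puts the first colour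
      -- of P v into its own tail.
      not-long : ∀ v → ¬ (suc m < length (P v))
      not-long v long = χ≥2⇒¬¬∃≢ G (proj₁ sc) v λ (w , v≢w) →
        take-suc⊈drop-1 m (proj₁ (P-wide v)) (≤-trans (s≤s z≤n) long) λ c∈Tv →
          shifted-at (shifted-constant w v _ (shifted-elsewhere w v≢w (truncated-constant v w _ c∈Tv)))
        where
        open Shifted v long
        shifted-constant : Constant shifted
        shifted-constant = tight-sublists-constant shifted shifted-tight shifted⊆P

      truncated≡P : ∀ v → truncated v ≡ P v
      truncated≡P v = take-all (suc m) (P v) (≮⇒≥ (not-long v))

    uncolorable-wide⇒constant-tight : KAssignment (suc m) P × Constant P
    uncolorable-wide⇒constant-tight =
      (λ v → proj₁ (P-wide v) , ≤-antisym (≮⇒≥ (not-long v)) (proj₂ (P-wide v))) ,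
      λ v w c c∈Pv → subst (c ∈_) (truncated≡P w)
                       (truncated-constant v w c (subst (c ∈_) (sym (truncated≡P v)) c∈Pv))

row : ∀ {n a} → (Σ (Fin n × StarV a) InU → ℕ) → Fin n → List ℕ
row f i = tabulate λ j → f ((i , u j) , tt)

residual : ∀ {n a} → (Fin n × StarV a → List ℕ) → (Σ (Fin n × StarV a) InU → ℕ) → Fin n → List ℕ
residual L f i = L (i , w₁) ∖ row f i

length-row : ∀ {n a} (f : Σ (Fin n × StarV a) InU → ℕ) i → length (row f i) ≡ a
length-row f i = length-tabulate (λ j → f ((i , u j) , tt))

∈-row : ∀ {n a} (f : Σ (Fin n × StarV a) InU → ℕ) i j → f ((i , u j) , tt) ∈ row f i
∈-row f i = ∈-tabulate⁺ {f = λ j → f ((i , u j) , tt)}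

common-colour⇒colorable : ∀ {n a} (M : Graph (Fin n)) {f c} →
  Proper (induced (M □ K[ a ,1]) InU) f → (∀ i → c ∈ row f i) → Colorable M a
common-colour⇒colorable M {f} {c} f-proper c∈row = copy , copy-proper
  where
  copy : Fin _ → Fin _
  copy i = proj₁ (∈-tabulate⁻ (c∈row i))

  copy-colour : ∀ i → c ≡ f ((i , u (copy i)) , tt)
  copy-colour i = proj₂ (∈-tabulate⁻ (c∈row i))

  copy-proper : Proper M copy
  copy-proper {i} {i'} i~i' same-copy =
    f-proper {(i , u (copy i)) , tt} {(i' , u (copy i)) , tt} (inj₂ (refl , i~i'))
      (trans (sym (copy-colour i)) (subst (λ j → c ≡ f ((i' , u j) , tt)) (sym same-copy) (copy-colour i')))

module _ {n a m : ℕ} (M : Graph (Fin n)) (sc : StrongChromaticChoosable M (suc (suc m)))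
         {L : Fin n × StarV a → List ℕ} (L-tight : KAssignment (suc m + a) L)
         {f : Σ (Fin n × StarV a) InU → ℕ} (f-bad : IsBad M L f) where

  bad⇒residual-uncolorable : ¬ LColorable M (memL (residual L f))
  bad⇒residual-uncolorable (col , col-proper , col∈residual) =
    proj₂ f-bad (lift , (λ {x} {y} → lift-proper {x} {y}) , lift∈)
    where
    lift : Σ (Fin n × StarV a) InW → ℕ
    lift ((i , _) , _) = col i

    lift-proper : Proper (induced (M □ K[ a ,1]) InW) lift
    lift-proper {(_ , inj₂ _) , _} {(_ , inj₂ _) , _} (inj₂ (_ , i~i')) = col-proper i~i'

    lift∈ : ∀ x → lift x ∈ L (proj₁ x) × (∀ j → f ((proj₁ (proj₁ x) , u j) , tt) ≢ lift x)
    lift∈ ((i , inj₂ tt) , tt) with c∈L , c∉row ← ∈-∖⁻ (L _) (row f i) (col∈residual i) =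
      c∈L , λ j f≡c → c∉row (subst (_∈ row f i) f≡c (∈-row f i j))

  residual-wide : ∀ i → Unique (residual L f i) × suc m ≤ length (residual L f i)
  residual-wide i = Unique.filter⁺ (_∉? row f i) (proj₁ (L-tight (i , w₁))) ,
    +-cancelʳ-≤ a (suc m) _ (begin
      suc m + a                                  ≡⟨ proj₂ (L-tight (i , w₁)) ⟨
      length (L (i , w₁))                        ≤⟨ length≤length-∖+length (row f i) (proj₁ (L-tight (i , w₁))) ⟩
      length (residual L f i) + length (row f i) ≡⟨ cong (length (residual L f i) +_) (length-row f i) ⟩
      length (residual L f i) + a                ∎)
    where open ≤-Reasoning

  bad⇒residual-constant-tight : KAssignment (suc m) (residual L f) × Constant (residual L f)
  bad⇒residual-constant-tight =
    uncolorable-wide⇒constant-tight _≟ᶠ_ M sc (residual L f) bad⇒residual-uncolorable residual-wide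

  bad⇒row⊆list : ∀ i → row f i ⊆ L (i , w₁)
  bad⇒row⊆list i {c} c∈row = decidable-stable (c ∈? L (i , w₁)) λ c∉L →
    n≮n (suc m + a) (begin-strict
      suc m + a                                  ≡⟨ proj₂ (L-tight (i , w₁)) ⟨
      length (L (i , w₁))                        <⟨ length<length-∖+length (row f i) (proj₁ (L-tight (i , w₁))) c∈row c∉L ⟩
      length (residual L f i) + length (row f i) ≡⟨ cong₂ _+_ (proj₂ (proj₁ bad⇒residual-constant-tight i)) (length-row f i) ⟩
      suc m + a                                  ∎)
    where open ≤-Reasoning

bad-colourings-agree : ∀ {n a m} (M : Graph (Fin n)) → a < suc (suc m) →
  (sc : StrongChromaticChoosable M (suc (suc m))) →
  {L : Fin n × StarV a → List ℕ} → KAssignment (suc m + a) L →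
  (∀ (i : Fin n) (j j' : Fin a) → j ≢ j' → ∀ c → c ∈ L (i , u j) → c ∈ L (i , u j') → ⊥) →
  {f g : Σ (Fin n × StarV a) InU → ℕ} → IsBad M L f → IsBad M L g →
  ∀ i j → f ((i , u j) , tt) ≡ g ((i , u j) , tt)
bad-colourings-agree M a<k sc {L} L-tight disjoint {f} {g} f-bad g-bad i j
  with f ((i , u j) , tt) ∈? row g i
... | no c∉row-g =
  ⊥-elim (proj₂ (proj₁ sc) _ a<k (common-colour⇒colorable M {f} (proj₁ (proj₁ f-bad)) c∈every-row))
  where
  c = f ((i , u j) , tt)

  c∈residual-g : ∀ i' → c ∈ residual L g i'
  c∈residual-g i' = proj₂ (bad⇒residual-constant-tight M sc L-tight g-bad) i i' c
    (∈-∖⁺ (bad⇒row⊆list M sc L-tight f-bad i (∈-row f i j)) c∉row-g)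

  c∉residual-f : ∀ i' → c ∉ residual L f i'
  c∉residual-f i' c∈ = proj₂ (∈-∖⁻ (L _) (row f i) (proj₂ (bad⇒residual-constant-tight M sc L-tight f-bad) i' i c c∈))
                         (∈-row f i j)

  c∈every-row : ∀ i' → c ∈ row f i'
  c∈every-row i' = decidable-stable (c ∈? row f i') λ c∉row →
    c∉residual-f i' (∈-∖⁺ (proj₁ (∈-∖⁻ (L _) (row g i') (c∈residual-g i'))) c∉row)
... | yes c∈row-g with j' , c≡g ← ∈-tabulate⁻ c∈row-g with j ≟ᶠ j'
...   | yes refl = c≡g
...   | no j≢j'  = ⊥-elim (disjoint i j j' j≢j' _ (∈-colour f-bad j)
                            (subst (_∈ L (i , u j')) (sym c≡g) (∈-colour g-bad j')))
  where
  ∈-colour : ∀ {h} → IsBad M L h → ∀ j → h ((i , u j) , tt) ∈ L (i , u j)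
  ∈-colour h-bad j = proj₂ (proj₁ h-bad) ((i , u j) , tt)

lemma3p4 : (a k n : ℕ) → k ≥ a + 1
    → (M : Graph (Fin n)) → StrongChromaticChoosable M k
    → (L : Fin n × StarV a → List ℕ) → KAssignment (k + a ∸ 1) L
    → (∀ (i : Fin n) (j j' : Fin a) → j ≢ j' → ∀ c
         → c ∈ L (i , u j) → c ∈ L (i , u j') → ⊥)
    → (f g : Σ (Fin n × StarV a) InU → ℕ)
    → IsBad M L f → IsBad M L g
    → ∀ x → f x ≡ g x
lemma3p4 a k n _ M sc L L-tight disjoint f g f-bad g-bad ((i , inj₂ tt) , ())
lemma3p4 a (suc (suc m)) n a+1≤k M sc L L-tight disjoint f g f-bad g-bad ((i , inj₁ j) , tt) =
  bad-colourings-agree M (subst (_≤ suc (suc m)) (+-comm a 1) a+1≤k) sc L-tight disjoint f-bad g-bad i j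
lemma3p4 zero k n _ M sc L L-tight disjoint f g f-bad g-bad ((i , inj₁ ()) , tt)
lemma3p4 (suc a) zero n () M sc L L-tight disjoint f g f-bad g-bad ((i , inj₁ j) , tt)
lemma3p4 (suc a) (suc zero) n (s≤s a+1≤0) M sc L L-tight disjoint f g f-bad g-bad ((i , inj₁ j) , tt) =
  contradiction (≤-trans (m≤n+m 1 a) a+1≤0) (λ ())
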